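{- Let $(N,T,f)$ be a linear game ladder. Then $\succeq$ is transitive: for all $i,j,k\in N$, if $i\succeq j$ and $j\succeq k$ then $i\succeq k$.
   Context: A game ladder is a triple $(N,T,f)$ where $N=\{1,\dots,n\}$ is a non-empty finite set of players, $T=\{1,\dots,m\}$ with $m\ge 2$ is an ordered set of positions (higher index = more important position), and $f:T^N\to\mathbb{R}$ is monotonic: for all $x,z\in T^N$ with $x\le z$ componentwise, $f(x)\le f(z)$. For $p\in N$, $e^p$ denotes the $p$-th unit vector. For players $p,q$ and positions $r>s$ in $T$, write $p\succeq_{(r,s)}q$ if for every $x\in T^N$ with $x_p=x_q=s$ one has $f(x+(r-s)e^p)\ge f(x+(r-s)e^q)$. Write $p\succeq q$ if $p\succeq_{(r,s)}q$ for all $r,s\in T$ with $r>s$. The game ladder is linear if $\succeq$ is complete, i.e. for all $p,q\in N$, $p\succeq q$ or $q\succeq p$.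
   Formalization: The function f takes values in ℚ rather than ℝ. -}

module Defs where

open import Data.Nat using (ℕ)
open import Data.Fin as Fin using (Fin; _≟_)
open import Data.Rational as ℚ using (ℚ)
open import Data.Sum using (_⊎_)
open import Relation.Binary.PropositionalEquality using (_≡_)
open import Relation.Nullary.Decidable using (yes; no)

-- Players are Fin n, positions are Fin m (Fin's order: larger index = more important).
-- A position profile x ∈ T^N is a function Fin n → Fin m.
Profile : ℕ → ℕ → Set
Profile n m = Fin n → Fin m

Payoff : ℕ → ℕ → Set
Payoff n m = Profile n m → ℚ

Monotone : ∀ {n m} → Payoff n m → Set
Monotone {n} {m} f =
  ∀ (x z : Profile n m) → (∀ p → x p Fin.≤ z p) → f x ℚ.≤ f z

-- x + (r - s) e^p when x p = s: the profile x with coordinate p set to r.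
update : ∀ {n m} → Profile n m → Fin n → Fin m → Profile n m
update x p r q with q ≟ p
... | yes _ = r
... | no  _ = x q

Dom⟨_,_⟩ : ∀ {n m} → Payoff n m → Fin m → Fin m → Fin n → Fin n → Set
Dom⟨_,_⟩ {n} {m} f r s p q =
  ∀ (x : Profile n m) → x p ≡ s → x q ≡ s →
  f (update x q r) ℚ.≤ f (update x p r)

Dom : ∀ {n m} → Payoff n m → Fin n → Fin n → Set
Dom {n} {m} f p q = ∀ (r s : Fin m) → s Fin.< r → Dom⟨_,_⟩ f r s p q

Linear : ∀ {n m} → Payoff n m → Set
Linear {n} f = ∀ (p q : Fin n) → Dom f p q ⊎ Dom f q p

{-# OPTIONS --safe #-}
-- p ⪰ q says exactly that giving the higher of two positions to p rather
-- than to q never lowers f. If i ⪰ k fails, linearity gives k ⪰ i, closing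
-- the cycle i ⪰ j ⪰ k ⪰ i; exchanging the positions of i and k is then a
-- product of three such favourable exchanges along the cycle, which product
-- depending on where the position of j lies relative to those of i and k.
module Submission where

open import Defs
open import Data.Nat using (ℕ; _≤_)
open import Data.Fin using (Fin; _≟_)
import Data.Fin as Fin
import Data.Fin.Properties as Finₚ
import Data.Nat.Properties as ℕₚ
import Data.Rational as ℚ
open import Data.Rational.Properties using (module ≤-Reasoning)
open import Data.Product using (_×_; _,_)
open import Data.Sum using (_⊎_; inj₁; inj₂)
open import Data.Empty using (⊥-elim)
open import Function using (_∘_)
open import Relation.Binary.PropositionalEquality
open import Relation.Nullary using (yes; no)

private
  variable
    n m : ℕ
    p q o t : Fin n
    a b c r s : Fin m
    x u v : Profile n m

update-updates : (x : Profile n m) (p : Fin n) (r : Fin m) → update x p r p ≡ r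
update-updates x p r with p ≟ p
... | yes _   = refl
... | no  p≢p = ⊥-elim (p≢p refl)

update-minimal : (x : Profile n m) (p : Fin n) (r : Fin m) → t ≢ p → update x p r t ≡ x t
update-minimal {t = t} x p r t≢p with t ≟ p
... | yes t≡p = ⊥-elim (t≢p t≡p)
... | no  _   = refl

≗-by-cases : (p q : Fin n) → u p ≡ v p → u q ≡ v q →
             (∀ t → t ≢ p → t ≢ q → u t ≡ v t) → u ≗ v
≗-by-cases p q eqp eqq rest t with t ≟ p | t ≟ q
... | yes refl | _        = eqp
... | no  _    | yes refl = eqq
... | no  t≢p  | no  t≢q  = rest t t≢p t≢q

Swapped : Fin n → Fin n → Profile n m → Profile n m → Set
Swapped p q u v = v p ≡ u q × v q ≡ u p × (∀ t → t ≢ p → t ≢ q → v t ≡ u t)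

IsUpdate₃ : Profile n m → Fin n × Fin m → Fin n × Fin m → Fin n × Fin m →
            Profile n m → Set
IsUpdate₃ x (p , a) (q , b) (o , c) u =
  u p ≡ a × u q ≡ b × u o ≡ c × (∀ t → t ≢ p → t ≢ q → t ≢ o → u t ≡ x t)

update₃ : Profile n m → Fin n × Fin m → Fin n × Fin m → Fin n × Fin m →
          Profile n m
update₃ x (p , a) (q , b) (o , c) = update (update (update x o c) q b) p a

update₃-isUpdate₃ : p ≢ q → q ≢ o → p ≢ o →
                    IsUpdate₃ x (p , a) (q , b) (o , c) (update₃ x (p , a) (q , b) (o , c))
update₃-isUpdate₃ {p = p} {q} {o} {x = x} {a} {b} {c} p≢q q≢o p≢o =
  update-updates _ p a ,
  trans (update-minimal _ p a (p≢q ∘ sym)) (update-updates _ q b) ,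
  trans (update-minimal _ p a (p≢o ∘ sym))
    (trans (update-minimal _ q b (q≢o ∘ sym)) (update-updates x o c)) ,
  λ t t≢p t≢q t≢o → trans (update-minimal _ p a t≢p)
    (trans (update-minimal _ q b t≢q) (update-minimal x o c t≢o))

update-isUpdate₃ : p ≢ o → q ≢ o → x p ≡ a → x q ≡ b →
                   IsUpdate₃ x (p , a) (q , b) (o , c) (update x o c)
update-isUpdate₃ {o = o} {x = x} {c = c} p≢o q≢o xp xq =
  trans (update-minimal x o c p≢o) xp , trans (update-minimal x o c q≢o) xq ,
  update-updates x o c , λ t _ _ t≢o → update-minimal x o c t≢o

IsUpdate₃-rotate : IsUpdate₃ x (p , a) (q , b) (o , c) u →
                   IsUpdate₃ x (q , b) (o , c) (p , a) u
IsUpdate₃-rotate (up , uq , uo , rest) =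
  uq , uo , up , λ t t≢q t≢o t≢p → rest t t≢p t≢q t≢o

IsUpdate₃⇒Swapped : IsUpdate₃ x (p , a) (q , b) (o , c) u →
                    IsUpdate₃ x (p , b) (q , a) (o , c) v → Swapped p q u v
IsUpdate₃⇒Swapped {p = p} {q = q} {o = o} {u = u} {v = v} (up , uq , uo , urest) (vp , vq , vo , vrest) =
  trans vp (sym uq) , trans vq (sym up) , off
  where
  off : ∀ t → t ≢ p → t ≢ q → v t ≡ u t
  off t t≢p t≢q with t ≟ o
  ... | yes refl = trans vo (sym uo)
  ... | no  t≢o  = trans (vrest t t≢p t≢q t≢o) (sym (urest t t≢p t≢q t≢o))

module _ {f : Payoff n m} (mono : Monotone f) where

  open ≤-Reasoning using (begin_; step-≤; _∎)

  ≗⇒≤ : u ≗ v → f u ℚ.≤ f v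
  ≗⇒≤ u≗v = mono _ _ (λ t → Finₚ.≤-reflexive (u≗v t))

  Dom⇒swap-≤ : Dom f p q → u p Fin.≤ u q → Swapped p q u v → f u ℚ.≤ f v
  Dom⇒swap-≤ {p = p} {q} {u} {v} dom up≤uq (vp , vq , rest) with u p ≟ u q
  ... | yes up≡uq = ≗⇒≤ (≗-by-cases p q (trans up≡uq (sym vp))
                                         (trans (sym up≡uq) (sym vq))
                                         (λ t t≢p t≢q → sym (rest t t≢p t≢q)))
  ... | no  up≢uq = begin
    f u                          ≤⟨ ≗⇒≤ u≗ ⟩
    f (update y q (u q))         ≤⟨ dom (u q) (u p) (Finₚ.≤∧≢⇒< up≤uq up≢uq) y yp yq ⟩
    f (update y p (u q))         ≤⟨ ≗⇒≤ ≗v ⟩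
    f v                          ∎
    where
    -- both players at the lower position, as in the definition of ⪰
    y : Profile n m
    y = update u q (u p)

    q≢p : q ≢ p
    q≢p refl = up≢uq refl

    yp : y p ≡ u p
    yp = update-minimal u q (u p) (q≢p ∘ sym)

    yq : y q ≡ u p
    yq = update-updates u q (u p)

    y-off : ∀ t → t ≢ q → y t ≡ u t
    y-off t = update-minimal u q (u p)

    u≗ : u ≗ update y q (u q)
    u≗ = ≗-by-cases p q
      (sym (trans (update-minimal y q (u q) (q≢p ∘ sym)) yp))
      (sym (update-updates y q (u q)))
      (λ t _ t≢q → sym (trans (update-minimal y q (u q) t≢q) (y-off t t≢q)))

    ≗v : update y p (u q) ≗ v
    ≗v = ≗-by-cases p q
      (trans (update-updates y p (u q)) (sym vp))
      (trans (update-minimal y p (u q) q≢p) (trans yq (sym vq)))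
      (λ t t≢p t≢q → trans (update-minimal y p (u q) t≢p)
                       (trans (y-off t t≢q) (sym (rest t t≢p t≢q))))

  Dom⇒update₃-swap-≤ : Dom f p q → a Fin.≤ b →
                       IsUpdate₃ x (p , a) (q , b) (o , c) u →
                       IsUpdate₃ x (p , b) (q , a) (o , c) v → f u ℚ.≤ f v
  Dom⇒update₃-swap-≤ dom a≤b U@(up , uq , _) V =
    Dom⇒swap-≤ dom (subst₂ Fin._≤_ (sym up) (sym uq) a≤b) (IsUpdate₃⇒Swapped U V)

  Dom-cycle : {i j k : Fin n} → i ≢ j → j ≢ k → i ≢ k →
              Dom f i j → Dom f j k → Dom f k i → Dom f i k
  Dom-cycle {i = i} {j} {k} i≢j j≢k i≢k Dij Djk Dki r s s<r x xi xk =
    chain (Finₚ.≤-total (x j) s) (Finₚ.≤-total (x j) r)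
    where
    s≤r : s Fin.≤ r
    s≤r = ℕₚ.<⇒≤ s<r

    profile : Fin m → Fin m → Fin m → Profile n m
    profile a b c = update₃ x (i , a) (j , b) (k , c)

    shape : ∀ a b c → IsUpdate₃ x (i , a) (j , b) (k , c) (profile a b c)
    shape _ _ _ = update₃-isUpdate₃ i≢j j≢k i≢k

    initial : IsUpdate₃ x (i , s) (j , x j) (k , r) (update x k r)
    initial = update-isUpdate₃ i≢k j≢k xi refl

    final : IsUpdate₃ x (i , r) (j , x j) (k , s) (update x i r)
    final = IsUpdate₃-rotate (IsUpdate₃-rotate
      (update-isUpdate₃ (i≢j ∘ sym) (i≢k ∘ sym) refl xk))

    swap-ij : ∀ {a b c u v} → a Fin.≤ b → IsUpdate₃ x (i , a) (j , b) (k , c) u →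
              IsUpdate₃ x (i , b) (j , a) (k , c) v → f u ℚ.≤ f v
    swap-ij = Dom⇒update₃-swap-≤ Dij

    swap-jk : ∀ {a b c u v} → b Fin.≤ c → IsUpdate₃ x (i , a) (j , b) (k , c) u →
              IsUpdate₃ x (i , a) (j , c) (k , b) v → f u ℚ.≤ f v
    swap-jk b≤c U V = Dom⇒update₃-swap-≤ Djk b≤c (IsUpdate₃-rotate U) (IsUpdate₃-rotate V)

    swap-ki : ∀ {a b c u v} → c Fin.≤ a → IsUpdate₃ x (i , a) (j , b) (k , c) u →
              IsUpdate₃ x (i , c) (j , b) (k , a) v → f u ℚ.≤ f v
    swap-ki c≤a U V = Dom⇒update₃-swap-≤ Dki c≤a
      (IsUpdate₃-rotate (IsUpdate₃-rotate U)) (IsUpdate₃-rotate (IsUpdate₃-rotate V))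

    chain : x j Fin.≤ s ⊎ s Fin.≤ x j → x j Fin.≤ r ⊎ r Fin.≤ x j →
            f (update x k r) ℚ.≤ f (update x i r)
    chain (inj₁ xj≤s) _ = begin
      f (update x k r)      ≤⟨ swap-jk (Finₚ.≤-trans xj≤s s≤r) initial (shape s r (x j)) ⟩
      f (profile s r (x j)) ≤⟨ swap-ki xj≤s (shape s r (x j)) (shape (x j) r s) ⟩
      f (profile (x j) r s) ≤⟨ swap-ij (Finₚ.≤-trans xj≤s s≤r) (shape (x j) r s) final ⟩
      f (update x i r)      ∎
    chain (inj₂ s≤xj) (inj₁ xj≤r) = begin
      f (update x k r)      ≤⟨ swap-ij s≤xj initial (shape (x j) s r) ⟩
      f (profile (x j) s r) ≤⟨ swap-jk s≤r (shape (x j) s r) (shape (x j) r s) ⟩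
      f (profile (x j) r s) ≤⟨ swap-ij xj≤r (shape (x j) r s) final ⟩
      f (update x i r)      ∎
    chain (inj₂ s≤xj) (inj₂ r≤xj) = begin
      f (update x k r)      ≤⟨ swap-ij s≤xj initial (shape (x j) s r) ⟩
      f (profile (x j) s r) ≤⟨ swap-ki r≤xj (shape (x j) s r) (shape r s (x j)) ⟩
      f (profile r s (x j)) ≤⟨ swap-jk s≤xj (shape r s (x j)) final ⟩
      f (update x i r)      ∎

proposition4 : (n m : ℕ) → 1 ≤ n → 2 ≤ m → (f : Payoff n m) → Monotone f →
    Linear f → (i j k : Fin n) → Dom f i j → Dom f j k → Dom f i k
proposition4 n m _ _ f mono lin i j k Dij Djk with lin i k
... | inj₁ Dik = Dik
... | inj₂ Dki with i ≟ j | j ≟ k | i ≟ k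
... | yes refl | _        | _        = Djk
... | no  _    | yes refl | _        = Dij
... | no  _    | no  _    | yes refl = Dki
... | no  i≢j  | no  j≢k  | no  i≢k  = Dom-cycle mono i≢j j≢k i≢k Dij Djk Dki
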